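{- (1-cut) In the multirole logic MRL over a set of roles $\mathcal{R}$, for every sequent $\Gamma$ and every formula $A$: if $\vdash\Gamma,[\emptyset]A$ is derivable, then $\vdash\Gamma$ is derivable.
   Context: Fix a set $\mathcal{R}$ (the set of roles), possibly infinite. For $R\subseteq\mathcal{R}$ write $\overline{R}=\mathcal{R}\setminus R$. Writing $R_1\uplus\cdots\uplus R_n$ means the union of the pairwise disjoint sets $R_1,\dots,R_n$ (the notation asserts disjointness). A filter on $\mathcal{R}$ is a set $\mathcal{F}$ of subsets of $\mathcal{R}$ with $\mathcal{R}\in\mathcal{F}$, such that $R_1\in\mathcal{F}$ and $R_1\subseteq R_2$ imply $R_2\in\mathcal{F}$, and $R_1,R_2\in\mathcal{F}$ imply $R_1\cap R_2\in\mathcal{F}$; an ultrafilter $\mathcal{U}$ is a filter such that for every $R\subseteq\mathcal{R}$, $R\in\mathcal{U}$ or $\overline{R}\in\mathcal{U}$. An endomorphism is any function $f:\mathcal{R}\to\mathcal{R}$, and $f^{ -1}(R)$ is the preimage. First-order terms $t$ and atomic formulas $a$ are standard. Formulas of MRL: $A ::= a \mid \neg_f(A) \mid A_1\wedge_{\mathcal{U}}A_2 \mid A\supset_{f,\mathcal{U}}B \mid \forall_{\mathcal{U}}(\lambda x.A)$, with $f$ an endomorphism and $\mathcal{U}$ an ultrafilter on $\mathcal{R}$; $A[x:=t]$ is substitution. An i-formula is $[R]A$ with $R\subseteq\mathcal{R}$ and $A$ a formula. A sequent $\Gamma$ is a finite multiset of i-formulas; commas denote multiset union. Derivable sequents $\vdash\Gamma$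 are generated by the rules: (Id) $\vdash\Gamma,[R_1]a,\dots,[R_n]a$ for any $\Gamma$, atomic $a$, $n\ge1$ and $R_1\uplus\cdots\uplus R_n=\mathcal{R}$; (contraction) from $\vdash\Gamma,[R]A,[R]A$ infer $\vdash\Gamma,[R]A$; ($\neg$) from $\vdash\Gamma,[f^{ -1}(R)]A$ infer $\vdash\Gamma,[R]\neg_f(A)$; ($\wedge$-neg) if $R\notin\mathcal{U}$, from $\vdash\Gamma,[R]A$ or from $\vdash\Gamma,[R]B$ infer $\vdash\Gamma,[R](A\wedge_{\mathcal{U}}B)$; ($\wedge$-pos) if $R\in\mathcal{U}$, from $\vdash\Gamma,[R]A$ and $\vdash\Gamma,[R]B$ infer $\vdash\Gamma,[R](A\wedge_{\mathcal{U}}B)$; ($\supset$-neg) if $R\notin\mathcal{U}$, from $\vdash\Gamma,[f^{ -1}(R)]A,[R]B$ infer $\vdash\Gamma,[R](A\supset_{f,\mathcal{U}}B)$; ($\supset$-pos) if $R\in\mathcal{U}$, from $\vdash\Gamma_1,[f^{ -1}(R)]A$ and $\vdash\Gamma_2,[R]B$ infer $\vdash\Gamma_1,\Gamma_2,[R](A\supset_{f,\mathcal{U}}B)$; ($\forall$-neg) if $R\notin\mathcal{U}$, from $\vdash\Gamma,[R]A[x:=t]$ for some term $t$ infer $\vdash\Gamma,[R]\forall_{\mathcal{U}}(\lambda x.A)$; ($\forall$-pos) if $R\in\mathcal{U}$ and $x$ has no free occurrence in $\Gamma$, from $\vdash\Gamma,[R]A$ infer $\vdash\Gamma,[R]\forall_{\mathcal{U}}(\lambda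 x.A)$. -}

module Defs where

open import Level using (0ℓ) renaming (suc to lsuc)
open import Data.Nat using (ℕ; zero; suc)
open import Data.Vec using (Vec; []; _∷_)
open import Data.List using (List; []; _∷_; _++_; map)
open import Data.List.Relation.Unary.Any using (Any)
open import Data.List.Relation.Unary.AllPairs using (AllPairs)
open import Data.Product using (_×_; _,_)
open import Data.Sum using (_⊎_)
open import Data.Empty using (⊥)
open import Function using (_∘_; _⇔_)
open import Relation.Nullary using (¬_)
open import Relation.Unary using (Pred; U; ∁; _∩_; _⊆_; _≐_; ∅)
open import Relation.Binary.PropositionalEquality using (_≡_; refl; sym; trans)
open import Relation.Binary.Bundles using (Setoid)
import Data.List.Relation.Binary.Permutation.Setoid as PermS

record Signature : Set₁ where
  field
    FunSym  : Set
    funAr   : FunSym → ℕ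
    PredSym : Set
    predAr  : PredSym → ℕ

module MRL (Role : Set) (Sig : Signature) where
  open Signature Sig

  -- Subsets of the set of roles ℛ (ℛ itself is `U`, the empty set is `∅`).
  Subset : Set₁
  Subset = Pred Role 0ℓ

  preimage : (Role → Role) → Subset → Subset
  preimage f R = R ∘ f

  Disjoint : Subset → Subset → Set
  Disjoint R S = ∀ r → R r → S r → ⊥

  Partition : List Subset → Set₁
  Partition Rs = AllPairs Disjoint Rs × (∀ r → Any (λ R → R r) Rs)

  -- Ultrafilters on ℛ (a filter is not required to be proper, as in the paper).
  record Ultrafilter : Set₁ where
    field
      _∋_   : Subset → Set
      full  : _∋_ U
      upw   : ∀ {R₁ R₂} → _∋_ R₁ → R₁ ⊆ R₂ → _∋_ R₂
      inter : ∀ {R₁ R₂} → _∋_ R₁ → _∋_ R₂ → _∋_ (R₁ ∩ R₂)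
      ultra : ∀ R → _∋_ R ⊎ _∋_ (∁ R)
  open Ultrafilter public using (_∋_)

  data Term : Set where
    var : ℕ → Term
    fun : (g : FunSym) → Vec Term (funAr g) → Term

  data Atom : Set where
    app : (p : PredSym) → Vec Term (predAr p) → Atom

  -- MRL formulas. `all𝒰 U A` binds de Bruijn variable 0 in A.
  data Formula : Set₁ where
    atom : Atom → Formula
    neg  : (Role → Role) → Formula → Formula
    conj : Ultrafilter → Formula → Formula → Formula
    impl : (Role → Role) → Ultrafilter → Formula → Formula → Formula
    all𝒰 : Ultrafilter → Formula → Formula

  Subst : Set
  Subst = ℕ → Term

  mutual
    substT : Subst → Term → Term
    substT σ (var x)    = σ x
    substT σ (fun g ts) = fun g (substTs σ ts)

    substTs : ∀ {n} → Subst → Vec Term n → Vec Term n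
    substTs σ []       = []
    substTs σ (t ∷ ts) = substT σ t ∷ substTs σ ts

  substA : Subst → Atom → Atom
  substA σ (app p ts) = app p (substTs σ ts)

  lift : Subst → Subst
  lift σ zero    = var zero
  lift σ (suc x) = substT (var ∘ suc) (σ x)

  substF : Subst → Formula → Formula
  substF σ (atom a)       = atom (substA σ a)
  substF σ (neg f A)      = neg f (substF σ A)
  substF σ (conj 𝒰 A B)   = conj 𝒰 (substF σ A) (substF σ B)
  substF σ (impl f 𝒰 A B) = impl f 𝒰 (substF σ A) (substF σ B)
  substF σ (all𝒰 𝒰 A)     = all𝒰 𝒰 (substF (lift σ) A)

  sub0 : Term → Subst
  sub0 t zero    = t
  sub0 t (suc x) = var x

  _[0≔_] : Formula → Term → Formula
  A [0≔ t ] = substF (sub0 t) A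

  shiftF : Formula → Formula
  shiftF = substF (var ∘ suc)

  record IFormula : Set₁ where
    constructor [_]_
    field
      set  : Subset
      form : Formula

  shiftI : IFormula → IFormula
  shiftI ([ R ] A) = [ R ] shiftF A

  _≈I_ : IFormula → IFormula → Set₁
  ([ R ] A) ≈I ([ S ] B) = (R ≐ S) × (A ≡ B)

  ≈I-setoid : Setoid (lsuc 0ℓ) (lsuc 0ℓ)
  ≈I-setoid = record
    { Carrier = IFormula
    ; _≈_ = _≈I_
    ; isEquivalence = record
      { refl  = ((λ x → x) , (λ x → x)) , refl
      ; sym   = λ { ((p , q) , e) → (q , p) , sym e }
      ; trans = λ { ((p , q) , e) ((p' , q') , e') → (p' ∘ p , q ∘ q') , trans e e' }
      }
    }

  -- Sequents: finite multisets of i-formulas, represented as lists up to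
  -- permutation (modulo ≈I), via the exchange rule below.
  Sequent : Set₁
  Sequent = List IFormula

  open PermS ≈I-setoid public using (_↭_)

  infix 2 ⊢_
  data ⊢_ : Sequent → Set₁ where
    exch     : ∀ {Γ Δ} → ⊢ Γ → Γ ↭ Δ → ⊢ Δ
    Id       : ∀ Γ (a : Atom) R Rs → Partition (R ∷ Rs) →
               ⊢ Γ ++ map (λ S → [ S ] atom a) (R ∷ Rs)
    contr    : ∀ {Γ R A} → ⊢ [ R ] A ∷ [ R ] A ∷ Γ → ⊢ [ R ] A ∷ Γ
    ¬-rule   : ∀ {Γ R f A} → ⊢ [ preimage f R ] A ∷ Γ → ⊢ [ R ] neg f A ∷ Γ
    ∧-neg₁   : ∀ {Γ R 𝒰 A B} → ¬ (𝒰 ∋ R) → ⊢ [ R ] A ∷ Γ → ⊢ [ R ] conj 𝒰 A B ∷ Γ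
    ∧-neg₂   : ∀ {Γ R 𝒰 A B} → ¬ (𝒰 ∋ R) → ⊢ [ R ] B ∷ Γ → ⊢ [ R ] conj 𝒰 A B ∷ Γ
    ∧-pos    : ∀ {Γ R 𝒰 A B} → 𝒰 ∋ R → ⊢ [ R ] A ∷ Γ → ⊢ [ R ] B ∷ Γ →
               ⊢ [ R ] conj 𝒰 A B ∷ Γ
    ⊃-neg    : ∀ {Γ R f 𝒰 A B} → ¬ (𝒰 ∋ R) →
               ⊢ [ preimage f R ] A ∷ [ R ] B ∷ Γ → ⊢ [ R ] impl f 𝒰 A B ∷ Γ
    ⊃-pos    : ∀ {Γ₁ Γ₂ R f 𝒰 A B} → 𝒰 ∋ R →
               ⊢ [ preimage f R ] A ∷ Γ₁ → ⊢ [ R ] B ∷ Γ₂ →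
               ⊢ [ R ] impl f 𝒰 A B ∷ (Γ₁ ++ Γ₂)
    ∀-neg    : ∀ {Γ R 𝒰 A} → ¬ (𝒰 ∋ R) → (t : Term) →
               ⊢ [ R ] (A [0≔ t ]) ∷ Γ → ⊢ [ R ] all𝒰 𝒰 A ∷ Γ
    -- eigenvariable condition in de Bruijn form: the context is shifted so
    -- that variable 0 does not occur free in it
    ∀-pos    : ∀ {Γ R 𝒰 A} → 𝒰 ∋ R →
               ⊢ [ R ] A ∷ map shiftI Γ → ⊢ [ R ] all𝒰 𝒰 A ∷ Γ

-- An i-formula labelled by the empty set of roles can be erased from any
-- derivation.  In an Id axiom it is a class of the partition, and the other
-- classes still partition ℛ (and form a nonempty list, as ℛ is inhabited).
-- If it is the principal formula of a logical rule, the relevant premise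
-- formulas are again labelled by empty sets (f⁻¹(∅) = ∅), so they are erased
-- recursively.  For ⊃-pos this keeps only the premise with context Γ₁, which
-- is why erasure is proved together with arbitrary weakening (_⊑_); for
-- ∀-pos it yields a shifted context, which a substitution undoes.

module Submission where

open import Defs
open import Data.Nat using (zero; suc)
open import Data.Vec using (Vec; []; _∷_)
open import Data.List using ([]; _∷_; _++_; map)
import Data.List.Properties as List
open import Data.List.Relation.Unary.All as All using (All; []; _∷_)
import Data.List.Relation.Unary.All.Properties as Allₚ
open import Data.List.Relation.Unary.Any using (Any; here; there)
open import Data.List.Relation.Unary.AllPairs using (AllPairs; []; _∷_)
open import Data.List.Relation.Binary.Sublist.Propositional using (_⊆_; []; _∷_; _∷ʳ_)
open import Data.List.Relation.Binary.Sublist.Propositional.Properties using (All-resp-⊆)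
import Data.List.Relation.Binary.Permutation.Setoid as Permutation
import Data.List.Relation.Binary.Permutation.Setoid.Properties as Permutationₚ
import Data.List.Membership.Setoid as Membership
import Data.List.Membership.Setoid.Properties as Membershipₚ
open import Data.Product using (∃; ∃₂; _×_; _,_)
open import Data.Sum using (_⊎_; inj₁; inj₂)
open import Data.Empty using (⊥-elim)
open import Function using (_∘_)
open import Relation.Binary.Bundles using (Setoid)
open import Relation.Binary.PropositionalEquality
  using (_≡_; _≗_; refl; sym; trans; cong; cong₂; subst; module ≡-Reasoning)
open import Relation.Unary using (∅; Empty)

module _ {a} {A : Set a} {r} {R : A → A → Set r} where

  AllPairs-resp-⊆ : ∀ {xs ys} → xs ⊆ ys → AllPairs R ys → AllPairs R xs
  AllPairs-resp-⊆ []          []         = []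
  AllPairs-resp-⊆ (_ ∷ʳ xs⊆ys) (_ ∷ pys)  = AllPairs-resp-⊆ xs⊆ys pys
  AllPairs-resp-⊆ (refl ∷ xs⊆ys) (py ∷ pys) =
    All-resp-⊆ xs⊆ys py ∷ AllPairs-resp-⊆ xs⊆ys pys

module _ {c ℓ} (S : Setoid c ℓ) where
  open Setoid S using () renaming (sym to ≈-sym)
  open Permutation S using (_↭_; ↭-trans; ↭-reflexive-≋)
  open Membership S using (_∈_)

  ∈⇒↭∷ : ∀ {x xs} → x ∈ xs → ∃ λ ys → xs ↭ x ∷ ys
  ∈⇒↭∷ x∈xs with ys , zs , _ , x≈w , eq ← Membershipₚ.∈-∃++ S x∈xs
    = ys ++ zs , ↭-trans (↭-reflexive-≋ eq) (Permutationₚ.shift S (≈-sym x≈w) ys zs)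

module CutAdmissibility (Role : Set) (Sig : Signature) where
  open MRL Role Sig
  open Setoid ≈I-setoid using () renaming (refl to ≈I-refl)
  open Permutation ≈I-setoid using (prep; ↭-sym; ↭-trans; ↭-reflexive)
  open Permutationₚ ≈I-setoid using (↭-shift; ++⁺ˡ; ++⁺ʳ; ++-comm; drop-∷; ∈-resp-↭; map⁺)

  infixr 9 _⊙_
  _⊙_ : Subst → Subst → Subst
  (σ ⊙ τ) x = substT σ (τ x)

  mutual
    substT-cong : ∀ {σ τ} → σ ≗ τ → ∀ t → substT σ t ≡ substT τ t
    substT-cong σ≗τ (var x)    = σ≗τ x
    substT-cong σ≗τ (fun g ts) = cong (fun g) (substTs-cong σ≗τ ts)

    substTs-cong : ∀ {n σ τ} → σ ≗ τ → (ts : Vec Term n) → substTs σ ts ≡ substTs τ ts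
    substTs-cong σ≗τ []       = refl
    substTs-cong σ≗τ (t ∷ ts) = cong₂ _∷_ (substT-cong σ≗τ t) (substTs-cong σ≗τ ts)

  mutual
    substT-⊙ : ∀ σ τ t → substT σ (substT τ t) ≡ substT (σ ⊙ τ) t
    substT-⊙ σ τ (var x)    = refl
    substT-⊙ σ τ (fun g ts) = cong (fun g) (substTs-⊙ σ τ ts)

    substTs-⊙ : ∀ {n} σ τ (ts : Vec Term n) → substTs σ (substTs τ ts) ≡ substTs (σ ⊙ τ) ts
    substTs-⊙ σ τ []       = refl
    substTs-⊙ σ τ (t ∷ ts) = cong₂ _∷_ (substT-⊙ σ τ t) (substTs-⊙ σ τ ts)

  mutual
    substT-var : ∀ t → substT var t ≡ t
    substT-var (var x)    = refl
    substT-var (fun g ts) = cong (fun g) (substTs-var ts)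

    substTs-var : ∀ {n} (ts : Vec Term n) → substTs var ts ≡ ts
    substTs-var []       = refl
    substTs-var (t ∷ ts) = cong₂ _∷_ (substT-var t) (substTs-var ts)

  lift-cong : ∀ {σ τ} → σ ≗ τ → lift σ ≗ lift τ
  lift-cong σ≗τ zero    = refl
  lift-cong σ≗τ (suc x) = cong (substT (var ∘ suc)) (σ≗τ x)

  lift-⊙ : ∀ σ τ → lift σ ⊙ lift τ ≗ lift (σ ⊙ τ)
  lift-⊙ σ τ zero    = refl
  lift-⊙ σ τ (suc x) =
    trans (substT-⊙ (lift σ) (var ∘ suc) (τ x)) (sym (substT-⊙ (var ∘ suc) σ (τ x)))

  lift-var : lift var ≗ var
  lift-var zero    = refl
  lift-var (suc x) = refl

  substF-cong : ∀ {σ τ} → σ ≗ τ → ∀ A → substF σ A ≡ substF τ A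
  substF-cong σ≗τ (atom (app p ts)) = cong (atom ∘ app p) (substTs-cong σ≗τ ts)
  substF-cong σ≗τ (neg f A)         = cong (neg f) (substF-cong σ≗τ A)
  substF-cong σ≗τ (conj 𝒰 A B)      = cong₂ (conj 𝒰) (substF-cong σ≗τ A) (substF-cong σ≗τ B)
  substF-cong σ≗τ (impl f 𝒰 A B)    = cong₂ (impl f 𝒰) (substF-cong σ≗τ A) (substF-cong σ≗τ B)
  substF-cong σ≗τ (all𝒰 𝒰 A)        = cong (all𝒰 𝒰) (substF-cong (lift-cong σ≗τ) A)

  substF-⊙ : ∀ σ τ A → substF σ (substF τ A) ≡ substF (σ ⊙ τ) A
  substF-⊙ σ τ (atom (app p ts)) = cong (atom ∘ app p) (substTs-⊙ σ τ ts)
  substF-⊙ σ τ (neg f A)         = cong (neg f) (substF-⊙ σ τ A)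
  substF-⊙ σ τ (conj 𝒰 A B)      = cong₂ (conj 𝒰) (substF-⊙ σ τ A) (substF-⊙ σ τ B)
  substF-⊙ σ τ (impl f 𝒰 A B)    = cong₂ (impl f 𝒰) (substF-⊙ σ τ A) (substF-⊙ σ τ B)
  substF-⊙ σ τ (all𝒰 𝒰 A)        =
    cong (all𝒰 𝒰) (trans (substF-⊙ (lift σ) (lift τ) A) (substF-cong (lift-⊙ σ τ) A))

  substF-var : ∀ A → substF var A ≡ A
  substF-var (atom (app p ts)) = cong (atom ∘ app p) (substTs-var ts)
  substF-var (neg f A)         = cong (neg f) (substF-var A)
  substF-var (conj 𝒰 A B)      = cong₂ (conj 𝒰) (substF-var A) (substF-var B)
  substF-var (impl f 𝒰 A B)    = cong₂ (impl f 𝒰) (substF-var A) (substF-var B)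
  substF-var (all𝒰 𝒰 A)        = cong (all𝒰 𝒰) (trans (substF-cong lift-var A) (substF-var A))

  substF-lift-shiftF : ∀ σ A → substF (lift σ) (shiftF A) ≡ shiftF (substF σ A)
  substF-lift-shiftF σ A =
    trans (substF-⊙ (lift σ) (var ∘ suc) A) (sym (substF-⊙ (var ∘ suc) σ A))

  shiftF-[0≔] : ∀ A t → shiftF A [0≔ t ] ≡ A
  shiftF-[0≔] A t = trans (substF-⊙ (sub0 t) (var ∘ suc) A) (substF-var A)

  substF-[0≔] : ∀ σ A t → substF σ (A [0≔ t ]) ≡ substF (lift σ) A [0≔ substT σ t ]
  substF-[0≔] σ A t = begin
    substF σ (A [0≔ t ])                     ≡⟨ substF-⊙ σ (sub0 t) A ⟩
    substF (σ ⊙ sub0 t) A                    ≡⟨ substF-cong commute A ⟩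
    substF (sub0 (substT σ t) ⊙ lift σ) A    ≡⟨ substF-⊙ (sub0 (substT σ t)) (lift σ) A ⟨
    substF (lift σ) A [0≔ substT σ t ]       ∎
    where
    open ≡-Reasoning
    commute : σ ⊙ sub0 t ≗ sub0 (substT σ t) ⊙ lift σ
    commute zero    = refl
    commute (suc x) =
      sym (trans (substT-⊙ (sub0 (substT σ t)) (var ∘ suc) (σ x)) (substT-var (σ x)))

  substI : Subst → IFormula → IFormula
  substI σ ([ R ] A) = [ R ] substF σ A

  substS : Subst → Sequent → Sequent
  substS σ = map (substI σ)

  substS-lift-shift : ∀ σ Γ → substS (lift σ) (map shiftI Γ) ≡ map shiftI (substS σ Γ)
  substS-lift-shift σ []              = refl
  substS-lift-shift σ (([ R ] A) ∷ Γ) =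
    cong₂ _∷_ (cong ([ R ]_) (substF-lift-shiftF σ A)) (substS-lift-shift σ Γ)

  substS-shift-[0≔] : ∀ t Γ → substS (sub0 t) (map shiftI Γ) ≡ Γ
  substS-shift-[0≔] t []              = refl
  substS-shift-[0≔] t (([ R ] A) ∷ Γ) =
    cong₂ _∷_ (cong ([ R ]_) (shiftF-[0≔] A t)) (substS-shift-[0≔] t Γ)

  atomAt : Atom → Subset → IFormula
  atomAt a S = [ S ] atom a

  ⊢-substS : ∀ {Γ} σ → ⊢ Γ → ⊢ substS σ Γ
  ⊢-substS σ (exch d p) =
    exch (⊢-substS σ d) (map⁺ ≈I-setoid (λ (R≐S , A≡B) → R≐S , cong (substF σ) A≡B) p)
  ⊢-substS σ (Id Γ a R Rs part) = subst ⊢_ eq (Id (substS σ Γ) (substA σ a) R Rs part)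
    where
    eq : substS σ Γ ++ map (atomAt (substA σ a)) (R ∷ Rs) ≡ substS σ (Γ ++ map (atomAt a) (R ∷ Rs))
    eq = trans (cong (substS σ Γ ++_) (List.map-∘ (R ∷ Rs))) (sym (List.map-++ (substI σ) Γ _))
  ⊢-substS σ (contr d)       = contr (⊢-substS σ d)
  ⊢-substS σ (¬-rule d)      = ¬-rule (⊢-substS σ d)
  ⊢-substS σ (∧-neg₁ u d)    = ∧-neg₁ u (⊢-substS σ d)
  ⊢-substS σ (∧-neg₂ u d)    = ∧-neg₂ u (⊢-substS σ d)
  ⊢-substS σ (∧-pos u d e)   = ∧-pos u (⊢-substS σ d) (⊢-substS σ e)
  ⊢-substS σ (⊃-neg u d)     = ⊃-neg u (⊢-substS σ d)
  ⊢-substS σ (⊃-pos {Γ₁} {Γ₂} u d e) =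
    subst (⊢_ ∘ (_ ∷_)) (sym (List.map-++ (substI σ) Γ₁ Γ₂))
      (⊃-pos u (⊢-substS σ d) (⊢-substS σ e))
  ⊢-substS σ (∀-neg {Γ} {R} {A = A} u t d) =
    ∀-neg u (substT σ t)
      (subst (⊢_ ∘ (_∷ substS σ Γ) ∘ [ R ]_) (substF-[0≔] σ A t) (⊢-substS σ d))
  ⊢-substS σ (∀-pos {Γ} u d) =
    ∀-pos u (subst (⊢_ ∘ (_ ∷_)) (substS-lift-shift σ Γ) (⊢-substS (lift σ) d))

  ⊢-unshift : ∀ {Γ} → ⊢ map shiftI Γ → ⊢ Γ
  ⊢-unshift {Γ} d = subst ⊢_ (substS-shift-[0≔] (var zero) Γ) (⊢-substS (sub0 (var zero)) d)

  ⊢-contract-++ : ∀ Ξ Δ → ⊢ Ξ ++ Δ ++ Δ → ⊢ Ξ ++ Δ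
  ⊢-contract-++ Ξ []      d = d
  ⊢-contract-++ Ξ (φ ∷ Δ) d =
    exch (⊢-contract-++ (φ ∷ Ξ) Δ (contr (exch d bring-φ-φ-forward))) (↭-sym (↭-shift Ξ Δ))
    where
    bring-φ-φ-forward : Ξ ++ φ ∷ Δ ++ φ ∷ Δ ↭ φ ∷ φ ∷ Ξ ++ Δ ++ Δ
    bring-φ-φ-forward = ↭-trans (↭-shift Ξ (Δ ++ φ ∷ Δ))
      (prep ≈I-refl (↭-trans (++⁺ˡ Ξ (↭-shift Δ Δ)) (↭-shift Ξ (Δ ++ Δ))))

  Void : IFormula → Set
  Void φ = Empty (IFormula.set φ)

  Void-resp-≈I : ∀ {φ ψ} → φ ≈I ψ → Void φ → Void ψ
  Void-resp-≈I ((_ , S⊆R) , _) void r = void r ∘ S⊆R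

  -- Δ ⊑ Γ: up to permutation, Γ arises from Δ by deleting some i-formulas
  -- with empty role set and adding arbitrary ones.
  infix 4 _⊑_
  _⊑_ : Sequent → Sequent → Set₁
  Δ ⊑ Γ = ∃₂ λ W Θ → All Void Θ × Δ ++ W ↭ Θ ++ Γ

  ⊑-refl : ∀ {Γ} → Γ ⊑ Γ
  ⊑-refl {Γ} = [] , [] , [] , ↭-reflexive (List.++-identityʳ Γ)

  ↭-⊑ : ∀ {Δ Δ′ Γ} → Δ ↭ Δ′ → Δ′ ⊑ Γ → Δ ⊑ Γ
  ↭-⊑ Δ↭Δ′ (W , Θ , void , p) = W , Θ , void , ↭-trans (++⁺ʳ W Δ↭Δ′) p

  ∷-⊑ : ∀ {φ Δ Γ} → Δ ⊑ Γ → φ ∷ Δ ⊑ φ ∷ Γ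
  ∷-⊑ {Γ = Γ} (W , Θ , void , p) = W , Θ , void , ↭-trans (prep ≈I-refl p) (↭-sym (↭-shift Θ Γ))

  Void-∷-⊑ : ∀ {φ Δ Γ} → Void φ → Δ ⊑ Γ → φ ∷ Δ ⊑ Γ
  Void-∷-⊑ vφ (W , Θ , void , p) = W , _ ∷ Θ , vφ ∷ void , prep ≈I-refl p

  ++-⊑ˡ : ∀ Δ₁ {Δ₂ Γ} → Δ₁ ++ Δ₂ ⊑ Γ → Δ₁ ⊑ Γ
  ++-⊑ˡ Δ₁ {Δ₂} (W , Θ , void , p) =
    Δ₂ ++ W , Θ , void , ↭-trans (↭-reflexive (sym (List.++-assoc Δ₁ Δ₂ W))) p

  ++-⊑ʳ : ∀ Δ₁ {Δ₂ Γ} → Δ₁ ++ Δ₂ ⊑ Γ → Δ₂ ⊑ Γ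
  ++-⊑ʳ Δ₁ {Δ₂} q = ++-⊑ˡ Δ₂ (↭-⊑ (++-comm Δ₂ Δ₁) q)

  map-shiftI-⊑ : ∀ {Δ Γ} → Δ ⊑ Γ → map shiftI Δ ⊑ map shiftI Γ
  map-shiftI-⊑ {Δ} {Γ} (W , Θ , void , p) =
    map shiftI W , map shiftI Θ , Allₚ.map⁺ void ,
    ↭-trans (↭-reflexive (sym (List.map-++ shiftI Δ W)))
      (↭-trans (map⁺ ≈I-setoid (λ (R≐S , A≡B) → R≐S , cong shiftF A≡B) p)
        (↭-reflexive (List.map-++ shiftI Θ Γ)))

  ⊑-inv : ∀ {φ Δ Γ} → φ ∷ Δ ⊑ Γ →
          (Void φ × Δ ⊑ Γ) ⊎ (∃ λ Γ′ → Γ ↭ φ ∷ Γ′ × Δ ⊑ Γ′)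
  ⊑-inv {Γ = Γ} (W , Θ , void , p)
    with Membershipₚ.∈-++⁻ ≈I-setoid Θ (∈-resp-↭ p (here ≈I-refl))
  ... | inj₁ φ∈Θ =
    let Θ′ , Θ↭ = ∈⇒↭∷ ≈I-setoid φ∈Θ
        void′ = Permutationₚ.All-resp-↭ ≈I-setoid Void-resp-≈I Θ↭ void
    in inj₁ (All.head void′ , W , Θ′ , All.tail void′ , drop-∷ (↭-trans p (++⁺ʳ Γ Θ↭)))
  ... | inj₂ φ∈Γ =
    let Γ′ , Γ↭ = ∈⇒↭∷ ≈I-setoid φ∈Γ
    in inj₂ (Γ′ , Γ↭ , W , Θ , void ,
             drop-∷ (↭-trans p (↭-trans (++⁺ˡ Θ Γ↭) (↭-shift Θ Γ′))))

  ⊑-∷-cases : ∀ {φ Δ Γ} → φ ∷ Δ ⊑ Γ →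
          (Void φ → Δ ⊑ Γ → ⊢ Γ) → (∀ {Γ′} → Δ ⊑ Γ′ → ⊢ φ ∷ Γ′) → ⊢ Γ
  ⊑-∷-cases q erased kept with ⊑-inv q
  ... | inj₁ (vφ , q′)       = erased vφ q′
  ... | inj₂ (Γ′ , Γ↭ , q′) = exch (kept q′) (↭-sym Γ↭)

  surviving-atoms : ∀ a L {Δ Γ} → map (atomAt a) L ++ Δ ⊑ Γ →
    ∃₂ λ L′ Γ₁ → L′ ⊆ L × (∀ r → Any (λ S → S r) L → Any (λ S → S r) L′)
                 × Γ ↭ Γ₁ ++ map (atomAt a) L′
  surviving-atoms a [] {Γ = Γ} q =
    [] , Γ , [] , (λ _ ()) , ↭-reflexive (sym (List.++-identityʳ Γ))
  surviving-atoms a (S ∷ L) q with ⊑-inv q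
  ... | inj₁ (vS , q′) =
    let L′ , Γ₁ , L′⊆L , covers , Γ↭ = surviving-atoms a L q′
    in L′ , Γ₁ , S ∷ʳ L′⊆L ,
       (λ { r (here Sr) → ⊥-elim (vS r Sr) ; r (there Lr) → covers r Lr }) , Γ↭
  ... | inj₂ (Γ′ , Γ↭ , q′) =
    let L′ , Γ₁ , L′⊆L , covers , Γ′↭ = surviving-atoms a L q′
    in S ∷ L′ , Γ₁ , refl ∷ L′⊆L ,
       (λ { r (here Sr) → here Sr ; r (there Lr) → there (covers r Lr) }) ,
       ↭-trans Γ↭ (↭-trans (prep ≈I-refl Γ′↭) (↭-sym (↭-shift Γ₁ _)))

  -- A role r₀ is needed: over an empty set of roles ⊢ [∅] a is an instance of Id.
  module _ (r₀ : Role) where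

    ⊢-Id-⊑ : ∀ a L {Δ Γ} → Partition L → map (atomAt a) L ++ Δ ⊑ Γ → ⊢ Γ
    ⊢-Id-⊑ a L (disjoint , covers) q with surviving-atoms a L q
    ... | [] , _ , _ , covers′ , _ with () ← covers′ r₀ (covers r₀)
    ... | T ∷ Ts , Γ₁ , L′⊆L , covers′ , Γ↭ =
      exch (Id Γ₁ a T Ts (AllPairs-resp-⊆ L′⊆L disjoint , λ r → covers′ r (covers r))) (↭-sym Γ↭)

    ⊢-resp-⊑ : ∀ {Δ Γ} → ⊢ Δ → Δ ⊑ Γ → ⊢ Γ
    ⊢-resp-⊑ (exch d p) q = ⊢-resp-⊑ d (↭-⊑ p q)
    ⊢-resp-⊑ (Id Γ₀ a R Rs part) q =
      ⊢-Id-⊑ a (R ∷ Rs) part (↭-⊑ (++-comm (map (atomAt a) (R ∷ Rs)) Γ₀) q)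
    ⊢-resp-⊑ (contr d) q = ⊑-∷-cases q
      (λ v q′ → ⊢-resp-⊑ d (Void-∷-⊑ v (Void-∷-⊑ v q′)))
      (λ q′ → contr (⊢-resp-⊑ d (∷-⊑ (∷-⊑ q′))))
    ⊢-resp-⊑ (¬-rule {f = f} d) q = ⊑-∷-cases q
      (λ v q′ → ⊢-resp-⊑ d (Void-∷-⊑ (v ∘ f) q′))
      (λ q′ → ¬-rule (⊢-resp-⊑ d (∷-⊑ q′)))
    ⊢-resp-⊑ (∧-neg₁ u d) q = ⊑-∷-cases q
      (λ v q′ → ⊢-resp-⊑ d (Void-∷-⊑ v q′))
      (λ q′ → ∧-neg₁ u (⊢-resp-⊑ d (∷-⊑ q′)))
    ⊢-resp-⊑ (∧-neg₂ u d) q = ⊑-∷-cases q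
      (λ v q′ → ⊢-resp-⊑ d (Void-∷-⊑ v q′))
      (λ q′ → ∧-neg₂ u (⊢-resp-⊑ d (∷-⊑ q′)))
    ⊢-resp-⊑ (∧-pos u d e) q = ⊑-∷-cases q
      (λ v q′ → ⊢-resp-⊑ d (Void-∷-⊑ v q′))
      (λ q′ → ∧-pos u (⊢-resp-⊑ d (∷-⊑ q′)) (⊢-resp-⊑ e (∷-⊑ q′)))
    ⊢-resp-⊑ (⊃-neg {f = f} u d) q = ⊑-∷-cases q
      (λ v q′ → ⊢-resp-⊑ d (Void-∷-⊑ (v ∘ f) (Void-∷-⊑ v q′)))
      (λ q′ → ⊃-neg u (⊢-resp-⊑ d (∷-⊑ (∷-⊑ q′))))
    ⊢-resp-⊑ (⊃-pos {Γ₁} {f = f} u d e) q = ⊑-∷-cases q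
      (λ v q′ → ⊢-resp-⊑ d (Void-∷-⊑ (v ∘ f) (++-⊑ˡ Γ₁ q′)))
      (λ {Γ′} q′ → ⊢-contract-++ (_ ∷ []) Γ′
         (⊃-pos u (⊢-resp-⊑ d (∷-⊑ (++-⊑ˡ Γ₁ q′))) (⊢-resp-⊑ e (∷-⊑ (++-⊑ʳ Γ₁ q′)))))
    ⊢-resp-⊑ (∀-neg u t d) q = ⊑-∷-cases q
      (λ v q′ → ⊢-resp-⊑ d (Void-∷-⊑ v q′))
      (λ q′ → ∀-neg u t (⊢-resp-⊑ d (∷-⊑ q′)))
    ⊢-resp-⊑ (∀-pos u d) q = ⊑-∷-cases q
      (λ v q′ → ⊢-unshift (⊢-resp-⊑ d (Void-∷-⊑ v (map-shiftI-⊑ q′))))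
      (λ q′ → ∀-pos u (⊢-resp-⊑ d (∷-⊑ (map-shiftI-⊑ q′))))

lemma3 : (Role : Set) (Sig : Signature) → Role →
    (Γ : MRL.Sequent Role Sig) (A : MRL.Formula Role Sig) →
    MRL.⊢_ Role Sig (MRL.[_]_ ∅ A ∷ Γ) → MRL.⊢_ Role Sig Γ
lemma3 Role Sig r₀ Γ A d = ⊢-resp-⊑ r₀ d (Void-∷-⊑ (λ _ ()) ⊑-refl)
  where open CutAdmissibility Role Sig
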